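{- Let $k\geq 1$ be an integer. There is a constant $c$ depending only on $k$ such that for every graph $P$ that is a path, and every $k$-tree $G$ that contains $P$ as a spanning subgraph (so that $P$ is a Hamiltonian path of $G$), every $(k+1)$-clique of $G$ has at most $c$ neighbors. In other words, Hamiltonian paths are bounded branching friendly.
   Context: $k$-trees are defined recursively: a $k$-tree with exactly $k$ vertices is a $k$-clique; for $n>k$, a $k$-tree with $n$ vertices is obtained from a $k$-tree with $n-1$ vertices by adding a new vertex adjacent to exactly the vertices of some existing $k$-clique. For a $(k+1)$-clique $\Delta$ of a $k$-tree $G$, a neighbor of $\Delta$ is a $(k+1)$-clique $\Delta'$ of $G$ with $|\Delta\cap\Delta'|=k$. A $k$-tree has bounded branches if every $(k+1)$-clique has a bounded number of neighbors; a graph $H$ is bounded branching friendly if every $k$-tree containing $H$ as a spanning subgraph has bounded branches (for a class of graphs, the bound is uniform over the class, depending only on the class and $k$). -}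

module Defs where

open import Data.Nat using (ℕ; zero; suc)
open import Data.Bool using (Bool; true; false; not; _∨_)
open import Data.Fin using (Fin; zero; suc; toℕ)
open import Data.Fin.Properties using () renaming (_≟_ to _≟ᶠ_)
open import Data.Fin.Subset using (Subset; _∈_; _∩_; ∣_∣)
open import Data.Vec using (lookup)
open import Data.Product using (Σ; _×_)
open import Function.Bundles using (_↔_; Inverse)
open import Relation.Binary.PropositionalEquality using (_≡_; _≢_)
open import Relation.Nullary.Decidable using (⌊_⌋)
import Data.Nat as ℕ

Graph : ℕ → Set
Graph n = Fin n → Fin n → Bool

complete : (n : ℕ) → Graph n
complete n u v = not ⌊ u ≟ᶠ v ⌋

IsClique : {n : ℕ} → Graph n → Subset n → Set
IsClique {n} G S = (u v : Fin n) → u ∈ S → v ∈ S → u ≢ v → G u v ≡ true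

extend : {n : ℕ} → Graph n → Subset n → Graph (suc n)
extend G S zero    zero    = false
extend G S zero    (suc v) = lookup S v
extend G S (suc u) zero    = lookup S u
extend G S (suc u) (suc v) = G u v

-- k-trees built by the recursive definition, with a canonical labelling
-- of the vertices (new vertices get the label zero).
data CanonKTree (k : ℕ) : (n : ℕ) → Graph n → Set where
  base : CanonKTree k k (complete k)
  step : {n : ℕ} {G : Graph n} → CanonKTree k n G →
         (S : Subset n) → ∣ S ∣ ≡ k → IsClique G S →
         CanonKTree k (suc n) (extend G S)

IsKTree : (k : ℕ) {n : ℕ} → Graph n → Set
IsKTree k {n} G =
  Σ (Graph n) λ H → CanonKTree k n H ×
    Σ (Fin n ↔ Fin n) λ σ →
      (u v : Fin n) → G u v ≡ H (Inverse.to σ u) (Inverse.to σ v)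

pathGraph : (n : ℕ) → Graph n
pathGraph n u v = (suc (toℕ u) ℕ.≡ᵇ toℕ v) ∨ (suc (toℕ v) ℕ.≡ᵇ toℕ u)

IsPath : {n : ℕ} → Graph n → Set
IsPath {n} P =
  Σ (Fin n ↔ Fin n) λ π →
    (u v : Fin n) → P u v ≡ pathGraph n (Inverse.to π u) (Inverse.to π v)

SpanningSubgraph : {n : ℕ} → Graph n → Graph n → Set
SpanningSubgraph {n} P G = (u v : Fin n) → P u v ≡ true → G u v ≡ true

IsNeighbor : (k : ℕ) {n : ℕ} → Graph n → Subset n → Subset n → Set
IsNeighbor k G Δ Δ' = IsClique G Δ' × ∣ Δ' ∣ ≡ suc k × ∣ Δ ∩ Δ' ∣ ≡ k

{-# OPTIONS --safe #-}
module Submission where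

-- Every neighbour of Δ has the form (Δ - v) ∪ {w} with v ∈ Δ and w ∉ Δ.  Rank each vertex by
-- the number of vertices of Δ at or before it on the Hamiltonian path; ranks lie in 0 … k+1.
-- The pair (rank v, rank w) determines the neighbour.  Rank is injective on Δ, which fixes v.
-- If two neighbours shared v but had distinct w, w' of equal rank, the path segment between
-- w and w' would avoid the k-clique K = Δ - v.  In a k-tree, however, two distinct vertices
-- adjacent to all of a k-clique K lie in different components of G − K (induction along the
-- construction).  So Δ has at most (k+2)² neighbours.

open import Defs
open import Data.Nat using (ℕ; suc; _≤_)
open import Data.Fin.Subset using (Subset; ∣_∣)
open import Data.List using (List; length)
open import Data.List.Relation.Unary.All using (All)
open import Data.List.Relation.Unary.Unique.Propositional using (Unique)
open import Data.Product using (∃)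
open import Relation.Binary.PropositionalEquality using (_≡_)

open import Data.Nat using (zero; _<_; s≤s; _+_; _∸_; _*_; _≤ᵇ_; _≡ᵇ_)
open import Data.Nat.Properties
  using (<⇒≱; <⇒≤; <⇒≢; ≰⇒>; <-irrefl; ≤-pred; ≤-trans; ≤-refl; ≤-reflexive; <-trans;
         n<1+n; <-cmp; +-identityʳ; +-suc; m≤m+n; m+[n∸m]≡n; ≤ᵇ⇒≤; ≤⇒≤ᵇ; ≡⇒≡ᵇ;
         suc-injective; _≤?_; +-0-commutativeMonoid)
open import Data.Bool using (Bool; true; false; _∨_)
open import Data.Bool.Properties using (T-≡)
open import Data.Fin using (Fin; zero; suc; toℕ; fromℕ<; combine; _≟_)
open import Data.Fin.Properties
  using (any?; pigeonhole; toℕ-injective; toℕ<n; toℕ-fromℕ<;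
         combine-injectiveˡ; combine-injectiveʳ)
  renaming (suc-injective to Fin-suc-injective; <⇒≢ to <⇒≢ᶠ)
open import Data.Fin.Permutation using (flip; inverseˡ; inverseʳ)
open import Data.Fin.Subset using (_∈_; _∉_; _⊆_; _-_; _∩_; _∪_; ⁅_⁆; ∁; ⊥; inside; outside)
open import Data.Fin.Subset.Properties
  using (_∈?_; ∈⊤; ∉⊥; ∣⊤∣≡n; drop-there; nonempty?; ⊆-antisym; p⊆q⇒∣p∣≤∣q∣; p⊂q⇒∣p∣<∣q∣;
         x∈p∩q⁺; x∈p∩q⁻; p∩q⊆p; p∩q⊆q; x∈p∪q⁺; x∈p∪q⁻; p⊆p∪q; q⊆p∪q; x∈⁅x⁆; x∈⁅y⁆⇒x≡y;
         p─q⊆p; p─⊥≡p; x∈p∧x≢y⇒x∈p-y; x∉p⇒x∈∁p; x∈∁p⇒x∉p)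
open import Data.Vec using (_∷_; lookup; tabulate; here; there)
open import Data.Vec.Properties using (lookup⇒[]=; []=⇒lookup; lookup∘tabulate; tabulate∘lookup)
import Data.List as List
open import Data.List.Membership.Propositional using () renaming (_∈_ to _∈ˡ_)
open import Data.List.Membership.Propositional.Properties using (∈-lookup)
import Data.List.Relation.Unary.All as All
open import Data.List.Relation.Unary.AllPairs using (_∷_)
open import Data.Product using (_×_; _,_; proj₁; proj₂)
open import Data.Sum using (_⊎_; inj₁; inj₂)
open import Function.Base using (_∘_)
open import Function.Bundles using (_↔_; Inverse; Injection; Equivalence)
open import Function.Properties.Inverse using (↔⇒↣)
open import Relation.Binary.Definitions using (tri<; tri≈; tri>)
open import Relation.Nullary using (¬_; yes; no; contradiction)
open import Relation.Nullary.Decidable using (decidable-stable; _×-dec_; ¬?)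
open import Relation.Binary.PropositionalEquality
  using (_≢_; refl; sym; trans; cong; cong₂; subst; module ≡-Reasoning)
open import Algebra.Properties.CommutativeMonoid.Sum +-0-commutativeMonoid using (sum; sum-permute)

private
  variable
    k n : ℕ
    G H : Graph n
    p q K S Δ Δ' : Subset n
    x y w w' : Fin n

x∉p-x : x ∉ p - x
x∉p-x {x = suc x} {p = _ ∷ p} = x∉p-x {p = p} ∘ drop-there

x∈p-y⇒x≢y : x ∈ p - y → x ≢ y
x∈p-y⇒x≢y {p = p} x∈p-y refl = x∉p-x {p = p} x∈p-y

x∈p⇒suc∣p-x∣≡∣p∣ : x ∈ p → suc ∣ p - x ∣ ≡ ∣ p ∣
x∈p⇒suc∣p-x∣≡∣p∣ {p = inside ∷ p}  here        = cong (suc ∘ ∣_∣) (p─⊥≡p p)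
x∈p⇒suc∣p-x∣≡∣p∣ {p = inside ∷ p}  (there x∈p) = cong suc (x∈p⇒suc∣p-x∣≡∣p∣ x∈p)
x∈p⇒suc∣p-x∣≡∣p∣ {p = outside ∷ p} (there x∈p) = x∈p⇒suc∣p-x∣≡∣p∣ x∈p

∣p∣<∣q∣⇒∃∈q∉p : ∣ p ∣ < ∣ q ∣ → ∃ λ x → x ∈ q × x ∉ p
∣p∣<∣q∣⇒∃∈q∉p {p = p} {q} ∣p∣<∣q∣ with any? (λ x → (x ∈? q) ×-dec ¬? (x ∈? p))
... | yes witness = witness
... | no ∄ = contradiction (p⊆q⇒∣p∣≤∣q∣ q⊆p) (<⇒≱ ∣p∣<∣q∣)
  where
    q⊆p : q ⊆ p
    q⊆p {x} x∈q = decidable-stable (x ∈? p) (λ x∉p → ∄ (x , x∈q , x∉p))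

∈q∉p-unique : p ⊆ q → ∣ q ∣ ≡ suc ∣ p ∣ → x ∈ q → x ∉ p → y ∈ q → y ∉ p → x ≡ y
∈q∉p-unique {p = p} {q} {x} {y} p⊆q ∣q∣≡1+∣p∣ x∈q x∉p y∈q y∉p =
  decidable-stable (x ≟ y) λ x≢y →
    <-irrefl ∣p∣≡∣q-x∣ (p⊂q⇒∣p∣<∣q∣ (p⊆q-x , y , x∈p∧x≢y⇒x∈p-y y∈q (x≢y ∘ sym) , y∉p))
  where
    p⊆q-x : p ⊆ q - x
    p⊆q-x z∈p = x∈p∧x≢y⇒x∈p-y (p⊆q z∈p) λ { refl → x∉p z∈p }
    ∣p∣≡∣q-x∣ : ∣ p ∣ ≡ ∣ q - x ∣
    ∣p∣≡∣q-x∣ = suc-injective (trans (sym ∣q∣≡1+∣p∣) (sym (x∈p⇒suc∣p-x∣≡∣p∣ x∈q)))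

∈-tabulate⁺ : {f : Fin n → Bool} → f x ≡ true → x ∈ tabulate f
∈-tabulate⁺ {x = x} {f} fx≡true = lookup⇒[]= x (tabulate f) (trans (lookup∘tabulate f x) fx≡true)

∈-tabulate⁻ : {f : Fin n → Bool} → x ∈ tabulate f → f x ≡ true
∈-tabulate⁻ {x = x} {f} x∈ = trans (sym (lookup∘tabulate f x)) ([]=⇒lookup x∈)

preimage : {m : ℕ} → (Fin m → Fin n) → Subset n → Subset m
preimage f p = tabulate (lookup p ∘ f)

∈-preimage⁺ : {m : ℕ} {f : Fin m → Fin n} {z : Fin m} → f z ∈ p → z ∈ preimage f p
∈-preimage⁺ fz∈p = ∈-tabulate⁺ ([]=⇒lookup fz∈p)

∈-preimage⁻ : {m : ℕ} {f : Fin m → Fin n} {z : Fin m} → z ∈ preimage f p → f z ∈ p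
∈-preimage⁻ {p = p} z∈ = lookup⇒[]= _ p (∈-tabulate⁻ z∈)

private
  indicator : Bool → ℕ
  indicator true  = 1
  indicator false = 0

  ∣tabulate∣≡sum : (f : Fin n → Bool) → ∣ tabulate f ∣ ≡ sum (indicator ∘ f)
  ∣tabulate∣≡sum {zero}  f = refl
  ∣tabulate∣≡sum {suc n} f with f zero
  ... | true  = cong suc (∣tabulate∣≡sum (f ∘ suc))
  ... | false = ∣tabulate∣≡sum (f ∘ suc)

∣preimage∣≡∣p∣ : (σ : Fin n ↔ Fin n) (p : Subset n) → ∣ preimage (Inverse.to σ) p ∣ ≡ ∣ p ∣
∣preimage∣≡∣p∣ σ p = begin
  ∣ tabulate (lookup p ∘ Inverse.to σ) ∣     ≡⟨ ∣tabulate∣≡sum (lookup p ∘ Inverse.to σ) ⟩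
  sum (indicator ∘ lookup p ∘ Inverse.to σ) ≡⟨ sum-permute (indicator ∘ lookup p) σ ⟨
  sum (indicator ∘ lookup p)                ≡⟨ ∣tabulate∣≡sum (lookup p) ⟨
  ∣ tabulate (lookup p) ∣                    ≡⟨ cong ∣_∣ (tabulate∘lookup p) ⟩
  ∣ p ∣                                      ∎
  where open ≡-Reasoning

record Exchange (Δ Δ' : Subset n) : Set where
  field
    removed   : Fin n
    added     : Fin n
    removed∈Δ : removed ∈ Δ
    added∉Δ   : added ∉ Δ
    Δ'≡       : Δ' ≡ (Δ - removed) ∪ ⁅ added ⁆

exchange : ∣ Δ ∣ ≡ suc ∣ Δ ∩ Δ' ∣ → ∣ Δ' ∣ ≡ suc ∣ Δ ∩ Δ' ∣ → Exchange Δ Δ'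
exchange {Δ = Δ} {Δ' = Δ'} ∣Δ∣≡1+∣I∣ ∣Δ'∣≡1+∣I∣
  with ∣p∣<∣q∣⇒∃∈q∉p (≤-reflexive (sym ∣Δ∣≡1+∣I∣)) | ∣p∣<∣q∣⇒∃∈q∉p (≤-reflexive (sym ∣Δ'∣≡1+∣I∣))
... | v , v∈Δ , v∉I | w , w∈Δ' , w∉I = record
  { removed = v ; added = w ; removed∈Δ = v∈Δ ; added∉Δ = w∉Δ ; Δ'≡ = ⊆-antisym Δ'⊆ ⊆Δ' }
  where
    w∉Δ : w ∉ Δ
    w∉Δ w∈Δ = w∉I (x∈p∩q⁺ (w∈Δ , w∈Δ'))
    Δ'⊆ : Δ' ⊆ (Δ - v) ∪ ⁅ w ⁆
    Δ'⊆ {x} x∈Δ' with x ∈? Δ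
    ... | yes x∈Δ = p⊆p∪q ⁅ w ⁆ (x∈p∧x≢y⇒x∈p-y x∈Δ λ { refl → v∉I (x∈p∩q⁺ (x∈Δ , x∈Δ')) })
    ... | no x∉Δ  = q⊆p∪q (Δ - v) ⁅ w ⁆ (subst (_∈ ⁅ w ⁆) (sym x≡w) (x∈⁅x⁆ w))
      where
        x≡w = ∈q∉p-unique (p∩q⊆q Δ Δ') ∣Δ'∣≡1+∣I∣ x∈Δ' (x∉Δ ∘ proj₁ ∘ x∈p∩q⁻ Δ Δ') w∈Δ' w∉I
    ⊆Δ' : (Δ - v) ∪ ⁅ w ⁆ ⊆ Δ'
    ⊆Δ' {x} x∈ with x∈p∪q⁻ (Δ - v) ⁅ w ⁆ x∈
    ... | inj₂ x∈⁅w⁆ = subst (_∈ Δ') (sym (x∈⁅y⁆⇒x≡y w x∈⁅w⁆)) w∈Δ'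
    ... | inj₁ x∈Δ-v = decidable-stable (x ∈? Δ') λ x∉Δ' →
      x∈p-y⇒x≢y x∈Δ-v (∈q∉p-unique (p∩q⊆p Δ Δ') ∣Δ∣≡1+∣I∣
                         (p─q⊆p Δ ⁅ v ⁆ x∈Δ-v) (x∉Δ' ∘ proj₂ ∘ x∈p∩q⁻ Δ Δ') v∈Δ v∉I)

Unique⇒lookup-injective : {A : Set} {xs : List A} → Unique xs →
                          ∀ i j → List.lookup xs i ≡ List.lookup xs j → i ≡ j
Unique⇒lookup-injective (_ ∷ _)     zero    zero    _  = refl
Unique⇒lookup-injective (x≢xs ∷ _)  zero    (suc j) eq = contradiction eq (All.lookup x≢xs (∈-lookup j))
Unique⇒lookup-injective (x≢xs ∷ _)  (suc i) zero    eq =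
  contradiction (sym eq) (All.lookup x≢xs (∈-lookup i))
Unique⇒lookup-injective (_ ∷ u)     (suc i) (suc j) eq = cong suc (Unique⇒lookup-injective u i j eq)

Unique⇒length≤ : {A : Set} {c : ℕ} {xs : List A} → Unique xs →
                 (f : ∀ {x} → x ∈ˡ xs → Fin c) →
                 (∀ {x y} (x∈ : x ∈ˡ xs) (y∈ : y ∈ˡ xs) → f x∈ ≡ f y∈ → x ≡ y) →
                 length xs ≤ c
Unique⇒length≤ {c = c} {xs} u f f-injective = decidable-stable (length xs ≤? c) λ len≰c →
  let (i , j , i<j , fi≡fj) = pigeonhole (≰⇒> len≰c) (f ∘ ∈-lookup)
  in <⇒≢ᶠ i<j (Unique⇒lookup-injective u i j (f-injective (∈-lookup i) (∈-lookup j) fi≡fj))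

Apex : Graph n → Subset n → Fin n → Set
Apex G K w = w ∉ K × (∀ {u} → u ∈ K → G w u ≡ true)

EdgeClosed : Graph n → Subset n → Subset n → Set
EdgeClosed G K C = ∀ {u x} → u ∈ C → x ∉ K → G u x ≡ true → x ∈ C

-- side ∖ K is a union of components of G − K containing w but not w'.
record Separates (G : Graph n) (K : Subset n) (w w' : Fin n) : Set where
  field
    side    : Subset n
    w∈side  : w ∈ side
    w'∉side : w' ∉ side
    closed  : EdgeClosed G K side

private
  new-apex⇒S⊆K : ∣ S ∣ ≡ k → k ≤ ∣ K ∣ → Apex (extend H S) (outside ∷ K) zero → S ⊆ K
  new-apex⇒S⊆K {S = S} {K = K} ∣S∣≡k k≤∣K∣ (_ , adj) {y} y∈S = decidable-stable (y ∈? K) λ y∉K →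
    <⇒≱ (p⊂q⇒∣p∣<∣q∣ (K⊆S , y , y∈S , y∉K)) (subst (_≤ ∣ K ∣) (sym ∣S∣≡k) k≤∣K∣)
    where
      K⊆S : K ⊆ S
      K⊆S u∈K = lookup⇒[]= _ S (adj (there u∈K))

  -- The new vertex joins the side iff its neighbourhood S meets it; S being a clique keeps
  -- the side closed.
  extend-separates : IsClique H S → Separates H K w w' →
                     Separates (extend H S) (outside ∷ K) (suc w) (suc w')
  extend-separates {H = H} {S = S} {K = K} S-clique sep with nonempty? (S ∩ Separates.side sep)
  ... | yes (s , s∈S∩side) = record
    { side = inside ∷ side ; w∈side = there w∈side ; w'∉side = w'∉side ∘ drop-there ; closed = closed⁺ }
    where
      open Separates sep
      s∈S    = proj₁ (x∈p∩q⁻ S side s∈S∩side)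
      s∈side = proj₂ (x∈p∩q⁻ S side s∈S∩side)
      closed⁺ : EdgeClosed (extend H S) (outside ∷ K) (inside ∷ side)
      closed⁺ {x = zero} _ _ _ = here
      closed⁺ {u = zero} {suc x} here x∉K edge with s ≟ x
      ... | yes refl = there s∈side
      ... | no s≢x   = there (closed s∈side (x∉K ∘ there) (S-clique s x s∈S (lookup⇒[]= x S edge) s≢x))
      closed⁺ {u = suc u} {suc x} (there u∈side) x∉K edge = there (closed u∈side (x∉K ∘ there) edge)
  ... | no S∩side≡∅ = record
    { side = outside ∷ side ; w∈side = there w∈side ; w'∉side = w'∉side ∘ drop-there ; closed = closed⁺ }
    where
      open Separates sep
      closed⁺ : EdgeClosed (extend H S) (outside ∷ K) (outside ∷ side)
      closed⁺ {u = suc u} {zero} (there u∈side) _ edge =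
        contradiction (u , x∈p∩q⁺ (lookup⇒[]= u S edge , u∈side)) S∩side≡∅
      closed⁺ {u = suc u} {suc x} (there u∈side) x∉K edge = there (closed u∈side (x∉K ∘ there) edge)

separates-canonical : CanonKTree k n H → IsClique H K → k ≤ ∣ K ∣ → w ≢ w' →
                      Apex H K w → Apex H K w' → Separates H K w w'
separates-canonical {k = k} {K = K} {w = w} base _ k≤∣K∣ _ (w∉K , _) _ =
  contradiction k≤∣K∣ (<⇒≱ (subst (∣ K ∣ <_) (∣⊤∣≡n k) (p⊂q⇒∣p∣<∣q∣ ((λ _ → ∈⊤) , w , ∈⊤ , w∉K))))
separates-canonical {K = inside ∷ K} {w = zero} (step _ _ _ _) _ _ _ (w∉K , _) _ = contradiction here w∉K
separates-canonical {K = inside ∷ K} {w' = zero} (step _ _ _ _) _ _ _ _ (w'∉K , _) =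
  contradiction here w'∉K
-- K ∖ {new} and both apexes lie in the k-set S, which is too small for them.
separates-canonical {k = k} {K = inside ∷ K} {w = suc a} {suc b} (step _ S ∣S∣≡k _)
                    K-clique k≤∣K∣ w≢w' (w∉K , w-adj) (w'∉K , w'-adj) =
  contradiction (≤-pred (subst (_≤ suc ∣ K ∣) k≡1+∣S-b∣ k≤∣K∣)) (<⇒≱ ∣K∣<∣S-b∣)
  where
    k≡1+∣S-b∣ : k ≡ suc ∣ S - b ∣
    k≡1+∣S-b∣ = sym (trans (x∈p⇒suc∣p-x∣≡∣p∣ (lookup⇒[]= b S (w'-adj here))) ∣S∣≡k)
    K⊆S-b : K ⊆ S - b
    K⊆S-b y∈K = x∈p∧x≢y⇒x∈p-y (lookup⇒[]= _ S (K-clique zero _ here (there y∈K) λ ()))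
                               λ { refl → w'∉K (there y∈K) }
    a∈S-b : a ∈ S - b
    a∈S-b = x∈p∧x≢y⇒x∈p-y (lookup⇒[]= a S (w-adj here)) (w≢w' ∘ cong suc)
    ∣K∣<∣S-b∣ : ∣ K ∣ < ∣ S - b ∣
    ∣K∣<∣S-b∣ = p⊂q⇒∣p∣<∣q∣ (K⊆S-b , a , a∈S-b , w∉K ∘ there)
separates-canonical {K = outside ∷ K} {w = zero} {zero} (step _ _ _ _) _ _ w≢w' _ _ =
  contradiction refl w≢w'
-- Here S = K: the new vertex sees only K, so it is a component of G − K on its own.
separates-canonical {K = outside ∷ K} {w = zero} {suc b} (step {G = H} _ S ∣S∣≡k _) _ k≤∣K∣ _ w-apex _ =
  record { side = inside ∷ ⊥ ; w∈side = here ; w'∉side = ∉⊥ ∘ drop-there ; closed = closed }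
  where
    closed : EdgeClosed (extend H S) (outside ∷ K) (inside ∷ ⊥)
    closed {x = zero} _ _ _ = here
    closed {x = suc x} here x∉K edge =
      contradiction (new-apex⇒S⊆K ∣S∣≡k k≤∣K∣ w-apex (lookup⇒[]= x S edge)) (x∉K ∘ there)
    closed (there u∈⊥) = contradiction u∈⊥ ∉⊥
separates-canonical {K = outside ∷ K} {w = suc a} {zero} (step {G = H} _ S ∣S∣≡k _)
                    _ k≤∣K∣ _ (w∉K , _) w'-apex =
  record { side = outside ∷ ∁ K ; w∈side = there (x∉p⇒x∈∁p (w∉K ∘ there)) ; w'∉side = λ ()
         ; closed = closed }
  where
    closed : EdgeClosed (extend H S) (outside ∷ K) (outside ∷ ∁ K)
    closed {u = suc u} {zero} (there u∈∁K) _ edge =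
      contradiction (new-apex⇒S⊆K ∣S∣≡k k≤∣K∣ w'-apex (lookup⇒[]= u S edge)) (x∈∁p⇒x∉p u∈∁K)
    closed {u = suc u} {suc x} _ x∉K _ = there (x∉p⇒x∈∁p (x∉K ∘ there))
separates-canonical {K = outside ∷ K} {w = suc a} {suc b} (step t S _ S-clique)
                    K-clique k≤∣K∣ w≢w' (w∉K , w-adj) (w'∉K , w'-adj) =
  extend-separates S-clique
    (separates-canonical t K-clique′ k≤∣K∣ (w≢w' ∘ cong suc)
       (w∉K ∘ there , w-adj ∘ there) (w'∉K ∘ there , w'-adj ∘ there))
  where
    K-clique′ : IsClique _ K
    K-clique′ u v u∈K v∈K u≢v =
      K-clique (suc u) (suc v) (there u∈K) (there v∈K) (u≢v ∘ Fin-suc-injective)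

separates : IsKTree k G → IsClique G K → k ≤ ∣ K ∣ → w ≢ w' →
            Apex G K w → Apex G K w' → Separates G K w w'
separates {k = k} {G = G} {K = K} (H , t , σ , G≡H∘σ) K-clique k≤∣K∣ w≢w' w-apex w'-apex = record
  { side    = preimage τ side
  ; w∈side  = ∈-preimage⁺ w∈side
  ; w'∉side = w'∉side ∘ ∈-preimage⁻
  ; closed  = λ {u} {x} u∈side x∉K edge →
      ∈-preimage⁺ (closed (∈-preimage⁻ u∈side) (x∉K ∘ ∈Kᴴ⇒∈K) (trans (sym (G≡H∘σ u x)) edge))
  }
  where
    τ = Inverse.to σ
    ι = Inverse.from σ
    Kᴴ = preimage ι K
    ∈Kᴴ⇒∈K : ∀ {x} → τ x ∈ Kᴴ → x ∈ K
    ∈Kᴴ⇒∈K τx∈Kᴴ = subst (_∈ K) (inverseˡ σ) (∈-preimage⁻ τx∈Kᴴ)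
    edgeᴴ : ∀ {x u} → G x (ι u) ≡ true → H (τ x) u ≡ true
    edgeᴴ {x} {u} edge = subst (λ v → H (τ x) v ≡ true) (inverseʳ σ) (trans (sym (G≡H∘σ x (ι u))) edge)
    Kᴴ-clique : IsClique H Kᴴ
    Kᴴ-clique u v u∈Kᴴ v∈Kᴴ u≢v = subst (λ x → H x v ≡ true) (inverseʳ σ)
      (edgeᴴ (K-clique (ι u) (ι v) (∈-preimage⁻ u∈Kᴴ) (∈-preimage⁻ v∈Kᴴ)
                       (u≢v ∘ Injection.injective (↔⇒↣ (flip σ)))))
    apexᴴ : ∀ {x} → Apex G K x → Apex H Kᴴ (τ x)
    apexᴴ (x∉K , x-adj) = x∉K ∘ ∈Kᴴ⇒∈K , λ u∈Kᴴ → edgeᴴ (x-adj (∈-preimage⁻ u∈Kᴴ))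
    open Separates
      (separates-canonical t Kᴴ-clique (subst (k ≤_) (sym (∣preimage∣≡∣p∣ (flip σ) K)) k≤∣K∣)
         (w≢w' ∘ Injection.injective (↔⇒↣ σ)) (apexᴴ w-apex) (apexᴴ w'-apex))

exchange-apex : IsClique G Δ' → (e : Exchange Δ Δ') →
                Apex G (Δ - Exchange.removed e) (Exchange.added e)
exchange-apex {Δ' = Δ'} {Δ = Δ} Δ'-clique e =
  added∉Δ ∘ p─q⊆p Δ _ ,
  λ u∈Δ-v → Δ'-clique added _ (∈Δ' (inj₂ (x∈⁅x⁆ added))) (∈Δ' (inj₁ u∈Δ-v))
              λ { refl → added∉Δ (p─q⊆p Δ _ u∈Δ-v) }
  where
    open Exchange e
    ∈Δ' : ∀ {x} → x ∈ Δ - removed ⊎ x ∈ ⁅ added ⁆ → x ∈ Δ'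
    ∈Δ' = subst (_ ∈_) (sym Δ'≡) ∘ x∈p∪q⁺

module HamiltonianPath {n : ℕ} {G P : Graph n} (P-path : IsPath P) (P⊆G : SpanningSubgraph P G) where

  private
    π : Fin n ↔ Fin n
    π = proj₁ P-path

    variable
      z : Fin n
      C : Subset n

  pos : Fin n → ℕ
  pos x = toℕ (Inverse.to π x)

  pos-injective : pos x ≡ pos y → x ≡ y
  pos-injective = Injection.injective (↔⇒↣ π) ∘ toℕ-injective

  vertexAt : ∀ {m} → m < n → Fin n
  vertexAt m<n = Inverse.from π (fromℕ< m<n)

  pos-vertexAt : ∀ {m} (m<n : m < n) → pos (vertexAt m<n) ≡ m
  pos-vertexAt m<n = trans (cong toℕ (inverseʳ π)) (toℕ-fromℕ< m<n)

  edge-to-successor : suc (pos x) ≡ pos y → G x y ≡ true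
  edge-to-successor {x} {y} eq = P⊆G x y (trans (proj₂ P-path x y)
    (cong (_∨ (suc (pos y) ≡ᵇ pos x)) (Equivalence.to T-≡ (≡⇒≡ᵇ _ _ eq))))

  closed-along-path : EdgeClosed G K C → ∀ m → pos y ≡ pos x + m → x ∈ C →
                      (∀ {z} → pos x < pos z → pos z ≤ pos y → z ∉ K) → y ∈ C
  closed-along-path {C = C} {y} {x} _ zero y≡x+0 x∈C _ =
    subst (_∈ C) (pos-injective (trans (sym (+-identityʳ (pos x))) (sym y≡x+0))) x∈C
  closed-along-path {C = C} {y} {x} closed (suc m) y≡x+m+1 x∈C avoids-K =
    closed y'∈C (avoids-K x<y ≤-refl) (edge-to-successor y'+1≡y)
    where
      y≡1+x+m : pos y ≡ suc (pos x + m)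
      y≡1+x+m = trans y≡x+m+1 (+-suc (pos x) m)
      x+m<n : pos x + m < n
      x+m<n = <-trans (n<1+n _) (subst (_< n) y≡1+x+m (toℕ<n (Inverse.to π y)))
      y' = vertexAt x+m<n
      y'+1≡y : suc (pos y') ≡ pos y
      y'+1≡y = trans (cong suc (pos-vertexAt x+m<n)) (sym y≡1+x+m)
      x<y : pos x < pos y
      x<y = subst (pos x <_) (sym y≡1+x+m) (s≤s (m≤m+n (pos x) m))
      y'∈C : y' ∈ C
      y'∈C = closed-along-path closed m (pos-vertexAt x+m<n) x∈C λ x<z z≤y' →
        avoids-K x<z (≤-trans z≤y' (<⇒≤ (≤-reflexive y'+1≡y)))

  before : Fin n → Subset n
  before x = tabulate (λ y → pos y ≤ᵇ pos x)

  ∈-before⁺ : pos y ≤ pos x → y ∈ before x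
  ∈-before⁺ y≤x = ∈-tabulate⁺ (Equivalence.to T-≡ (≤⇒≤ᵇ y≤x))

  ∈-before⁻ : y ∈ before x → pos y ≤ pos x
  ∈-before⁻ y∈ = ≤ᵇ⇒≤ _ _ (Equivalence.from T-≡ (∈-tabulate⁻ y∈))

  rank : Subset n → Fin n → ℕ
  rank Δ x = ∣ Δ ∩ before x ∣

  rank≤∣Δ∣ : rank Δ x ≤ ∣ Δ ∣
  rank≤∣Δ∣ {Δ = Δ} {x} = p⊆q⇒∣p∣≤∣q∣ (p∩q⊆p Δ (before x))

  rank-< : z ∈ Δ → pos x < pos z → pos z ≤ pos y → rank Δ x < rank Δ y
  rank-< {z = z} {Δ} {x} {y} z∈Δ x<z z≤y = p⊂q⇒∣p∣<∣q∣
    (mono , z , x∈p∩q⁺ (z∈Δ , ∈-before⁺ z≤y) , <⇒≱ x<z ∘ ∈-before⁻ ∘ proj₂ ∘ x∈p∩q⁻ Δ (before x))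
    where
      mono : Δ ∩ before x ⊆ Δ ∩ before y
      mono u∈ with x∈p∩q⁻ Δ (before x) u∈
      ... | u∈Δ , u≤x = x∈p∩q⁺ (u∈Δ , ∈-before⁺ (≤-trans (∈-before⁻ u≤x) (≤-trans (<⇒≤ x<z) z≤y)))

  rank-injective : x ∈ Δ → y ∈ Δ → rank Δ x ≡ rank Δ y → x ≡ y
  rank-injective {x} {y = y} x∈Δ y∈Δ eq with <-cmp (pos x) (pos y)
  ... | tri< x<y _ _ = contradiction eq (<⇒≢ (rank-< y∈Δ x<y ≤-refl))
  ... | tri≈ _ x≡y _ = pos-injective x≡y
  ... | tri> _ _ y<x = contradiction (sym eq) (<⇒≢ (rank-< x∈Δ y<x ≤-refl))

  sameRank⇒¬Separates : K ⊆ Δ → pos w < pos w' → rank Δ w ≡ rank Δ w' → ¬ Separates G K w w'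
  sameRank⇒¬Separates {K = K} {Δ} {w} {w'} K⊆Δ w<w' eq sep =
    w'∉side (closed-along-path closed (pos w' ∸ pos w) (sym (m+[n∸m]≡n (<⇒≤ w<w'))) w∈side avoids-K)
    where
      open Separates sep
      avoids-K : ∀ {z} → pos w < pos z → pos z ≤ pos w' → z ∉ K
      avoids-K w<z z≤w' z∈K = <⇒≢ (rank-< (K⊆Δ z∈K) w<z z≤w') eq

module BoundedBranching {k n : ℕ} {G P : Graph n} (G-ktree : IsKTree k G)
  (P-path : IsPath P) (P⊆G : SpanningSubgraph P G)
  {Δ : Subset n} (Δ-clique : IsClique G Δ) (∣Δ∣≡1+k : ∣ Δ ∣ ≡ suc k) where

  open HamiltonianPath P-path P⊆G

  private
    variable
      v w₁ w₂ : Fin n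
      Δ₁ Δ₂ : Subset n

  removal-separates : v ∈ Δ → w₁ ≢ w₂ → Apex G (Δ - v) w₁ → Apex G (Δ - v) w₂ →
                      Separates G (Δ - v) w₁ w₂
  removal-separates {v} v∈Δ = separates G-ktree
    (λ u u' u∈ u'∈ → Δ-clique u u' (p─q⊆p Δ ⁅ v ⁆ u∈) (p─q⊆p Δ ⁅ v ⁆ u'∈))
    (≤-reflexive (sym (suc-injective (trans (x∈p⇒suc∣p-x∣≡∣p∣ v∈Δ) ∣Δ∣≡1+k))))

  apexes-differ-in-rank : v ∈ Δ → w₁ ≢ w₂ → Apex G (Δ - v) w₁ → Apex G (Δ - v) w₂ →
                          rank Δ w₁ ≢ rank Δ w₂
  apexes-differ-in-rank {v} {w₁} {w₂} v∈Δ w₁≢w₂ apex₁ apex₂ eq with <-cmp (pos w₁) (pos w₂)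
  ... | tri< w₁<w₂ _ _ =
    sameRank⇒¬Separates (p─q⊆p Δ ⁅ v ⁆) w₁<w₂ eq (removal-separates v∈Δ w₁≢w₂ apex₁ apex₂)
  ... | tri≈ _ w₁≡w₂ _ = w₁≢w₂ (pos-injective w₁≡w₂)
  ... | tri> _ _ w₂<w₁ =
    sameRank⇒¬Separates (p─q⊆p Δ ⁅ v ⁆) w₂<w₁ (sym eq) (removal-separates v∈Δ (w₁≢w₂ ∘ sym) apex₂ apex₁)

  exchangeOf : IsNeighbor k G Δ Δ₁ → Exchange Δ Δ₁
  exchangeOf (_ , ∣Δ₁∣≡1+k , ∣Δ∩Δ₁∣≡k) =
    exchange (trans ∣Δ∣≡1+k (cong suc (sym ∣Δ∩Δ₁∣≡k))) (trans ∣Δ₁∣≡1+k (cong suc (sym ∣Δ∩Δ₁∣≡k)))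

  rankFin : Fin n → Fin (suc (suc k))
  rankFin x = fromℕ< (s≤s (subst (rank Δ x ≤_) ∣Δ∣≡1+k (rank≤∣Δ∣ {Δ = Δ} {x})))

  rankFin≡⇒rank≡ : rankFin x ≡ rankFin y → rank Δ x ≡ rank Δ y
  rankFin≡⇒rank≡ eq = trans (sym (toℕ-fromℕ< _)) (trans (cong toℕ eq) (toℕ-fromℕ< _))

  signature : IsNeighbor k G Δ Δ₁ → Fin (suc (suc k) * suc (suc k))
  signature nb = combine (rankFin removed) (rankFin added)
    where open Exchange (exchangeOf nb)

  signature-injective : (nb₁ : IsNeighbor k G Δ Δ₁) (nb₂ : IsNeighbor k G Δ Δ₂) →
                        signature nb₁ ≡ signature nb₂ → Δ₁ ≡ Δ₂
  signature-injective {Δ₁} {Δ₂} nb₁ nb₂ eq = begin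
    Δ₁                              ≡⟨ E₁.Δ'≡ ⟩
    (Δ - E₁.removed) ∪ ⁅ E₁.added ⁆ ≡⟨ cong₂ (λ v w → (Δ - v) ∪ ⁅ w ⁆) removed≡ added≡ ⟩
    (Δ - E₂.removed) ∪ ⁅ E₂.added ⁆ ≡⟨ E₂.Δ'≡ ⟨
    Δ₂                              ∎
    where
      open ≡-Reasoning
      module E₁ = Exchange (exchangeOf nb₁)
      module E₂ = Exchange (exchangeOf nb₂)
      removed≡ : E₁.removed ≡ E₂.removed
      removed≡ = rank-injective E₁.removed∈Δ E₂.removed∈Δ
        (rankFin≡⇒rank≡ (combine-injectiveˡ _ (rankFin E₁.added) _ (rankFin E₂.added) eq))
      apex₁ : Apex G (Δ - E₁.removed) E₁.added
      apex₁ = exchange-apex (proj₁ nb₁) (exchangeOf nb₁)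
      apex₂ : Apex G (Δ - E₁.removed) E₂.added
      apex₂ = subst (λ v → Apex G (Δ - v) E₂.added) (sym removed≡)
                (exchange-apex (proj₁ nb₂) (exchangeOf nb₂))
      added≡ : E₁.added ≡ E₂.added
      added≡ = decidable-stable (E₁.added ≟ E₂.added) λ w₁≢w₂ →
        apexes-differ-in-rank E₁.removed∈Δ w₁≢w₂ apex₁ apex₂
          (rankFin≡⇒rank≡ (combine-injectiveʳ (rankFin E₁.removed) _ (rankFin E₂.removed) _ eq))

mainTheorem3 : (k : ℕ) → 1 ≤ k → ∃ λ (c : ℕ) →
    (n : ℕ) (G P : Graph n) → IsKTree k G → IsPath P → SpanningSubgraph P G →
    (Δ : Subset n) → IsClique G Δ → ∣ Δ ∣ ≡ suc k →
    (L : List (Subset n)) → Unique L → All (IsNeighbor k G Δ) L →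
    length L ≤ c
mainTheorem3 k _ = suc (suc k) * suc (suc k) ,
  λ n G P G-ktree P-path P⊆G Δ Δ-clique ∣Δ∣≡1+k L L-unique L-neighbours →
    let open BoundedBranching G-ktree P-path P⊆G Δ-clique ∣Δ∣≡1+k
        neighbour = All.lookup L-neighbours
    in Unique⇒length≤ L-unique (λ Δ₁∈L → signature (neighbour Δ₁∈L))
         (λ Δ₁∈L Δ₂∈L → signature-injective (neighbour Δ₁∈L) (neighbour Δ₂∈L))
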